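{- (1) Let $P'_n$ be an orientation of a path $P_n$ on $n\geq 2$ vertices. Then for every $\ell\geq 2$ it holds $P'_n\in S_{n-1,\ell}$, but for every $\ell\geq 1$ it holds $P'_n\notin S_{n-2,\ell}$. (2) Let $C'_n$ be an orientation of a cycle $C_n$ on $n\geq 4$ vertices. Then for every $\ell\geq 2$ it holds $C'_n\in S_{n,\ell}$, but for every $\ell\geq 1$ it holds $C'_n\notin S_{n-1,\ell}$.
   Context: An orientation of an undirected graph replaces each edge $\{u,v\}$ by exactly one of the arcs $(u,v)$, $(v,u)$. A set of sequences $Q$ consists of sequences of pairwise distinct items, each with a type. The sequence digraph $g(Q)$ has as vertex set the set of all types occurring in $Q$, and an arc $(u,v)$ iff $u\neq v$ and in some sequence an item of type $u$ occurs at a position strictly before an item of type $v$. $S_{k,\ell}$ is the class of all digraphs $g(Q)$ with $Q$ consisting of at most $k$ sequences and containing, summed over all sequences, at most $\ell$ items of each type (for $k=0$ this allows only the empty set of sequences). -}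

module Defs where

open import Data.Nat using (ℕ; zero; suc; _+_; _≤_; _<_; _≟_)
open import Data.Fin using (Fin; toℕ)
open import Data.Bool using (Bool; true; false)
open import Data.List using (List; []; _∷_; length; lookup)
open import Data.List.Membership.Propositional using (_∈_)
open import Data.Product using (Σ; ∃; _×_; _,_)
open import Data.Sum using (_⊎_)
open import Relation.Nullary using (¬_; yes; no)
open import Relation.Binary.PropositionalEquality using (_≡_)
open import Function.Definitions using (Injective)
open import Function.Bundles using (_⇔_)

Digraph : ℕ → Set₁
Digraph n = Fin n → Fin n → Set

-- Items are pairwise distinct within a sequence, so a sequence is
-- determined (for all purposes here) by the list of the types of its
-- items, in order.  Types are natural numbers.
Seq : Set
Seq = List ℕ

occSeq : ℕ → Seq → ℕ
occSeq t [] = 0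
occSeq t (x ∷ xs) with t ≟ x
... | yes _ = suc (occSeq t xs)
... | no  _ = occSeq t xs

occ : ℕ → List Seq → ℕ
occ t [] = 0
occ t (s ∷ Q) = occSeq t s + occ t Q

Occurs : ℕ → List Seq → Set
Occurs t Q = Σ Seq λ s → s ∈ Q × t ∈ s

GArc : List Seq → ℕ → ℕ → Set
GArc Q u v = ¬ (u ≡ v) × Σ Seq λ s → s ∈ Q ×
  Σ (Fin (length s)) λ i → Σ (Fin (length s)) λ j →
    toℕ i < toℕ j × lookup s i ≡ u × lookup s j ≡ v

-- The isomorphism is an
-- injective map f from the vertices of D onto the vertex set of g(Q)
-- (the occurring types) that preserves and reflects arcs.
InS : ℕ → ℕ → {n : ℕ} → Digraph n → Set
InS k ℓ {n} D = Σ (List Seq) λ Q →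
  length Q ≤ k × (∀ t → occ t Q ≤ ℓ) ×
  Σ (Fin n → ℕ) λ f →
    Injective _≡_ _≡_ f ×
    (∀ i → Occurs (f i) Q) ×
    (∀ t → Occurs t Q → ∃ λ i → f i ≡ t) ×
    (∀ i j → D i j ⇔ GArc Q (f i) (f j))

PathOr : (n : ℕ) → (Fin (Data.Nat.pred n) → Bool) → Digraph n
PathOr n o u v = Σ (Fin (Data.Nat.pred n)) λ e →
    (o e ≡ true  × toℕ u ≡ toℕ e × toℕ v ≡ suc (toℕ e))
  ⊎ (o e ≡ false × toℕ u ≡ suc (toℕ e) × toℕ v ≡ toℕ e)

Next : {n : ℕ} → Fin n → Fin n → Set
Next {n} e w = (suc (toℕ e) ≡ toℕ w) ⊎ (suc (toℕ e) ≡ n × toℕ w ≡ 0)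

CycleOr : (n : ℕ) → (Fin n → Bool) → Digraph n
CycleOr n o u v = Σ (Fin n) λ e →
    (o e ≡ true  × u ≡ e × Next e v)
  ⊎ (o e ≡ false × Next e u × v ≡ e)

-- Both bounds are proved for digraphs presented by an oriented edge family:
-- m distinct edges {left e, right e} on Fin n, each oriented by a bit, such
-- that every vertex is a left endpoint at most once and a right endpoint at
-- most once (so every vertex has degree at most 2).
--
-- Upper bound: one two-item sequence per edge, listing its endpoints in the
-- direction of the arc, realises such a digraph with m sequences, and every
-- type occurs at most twice in total.
--
-- Lower bound: any two types in a common sequence are adjacent in g(Q).  So
-- if the underlying graph is triangle-free, a sequence contains the
-- endpoints of at most one edge; choosing for each edge a sequence
-- witnessing it is then injective, and there are at least m sequences.
--
-- The oriented path on n
-- vertices is presented by n-1 edges and the oriented cycle on n ≥ 4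
-- vertices by n edges; both are triangle-free (checked on the vertex
-- numbers in ℕ) and covered by their edges, which gives the theorem.

module Submission where

open import Defs
open import Data.Nat using (ℕ; zero; suc; _+_; _≤_; _<_; _∸_; pred; z≤n; s≤s; _%_; _≟_)
open import Data.Nat.DivMod using (_mod_; m<n⇒m%n≡m; n%n≡0)
open import Data.Nat.Properties
  using (≤-trans; ≤-reflexive; <-cmp; +-comm; +-mono-≤; m≤n⇒m<n∨m≡n; <⇒≢; 1+n≰n; +-commutativeSemigroup)
open import Algebra.Properties.CommutativeSemigroup +-commutativeSemigroup using (interchange)
open import Data.Fin as Fin using (Fin; zero; suc; toℕ; inject₁)
open import Data.Fin.Properties
  using (toℕ-injective; toℕ-fromℕ<; toℕ<n; injective⇒≤; suc-injective; 0≢1+n; inject₁-injective; toℕ-inject₁)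
open import Data.Bool using (Bool; true; false)
open import Data.List using (List; []; _∷_; length; lookup; tabulate)
open import Data.List.Membership.Propositional using (_∈_)
open import Data.List.Membership.Propositional.Properties using (∈-tabulate⁺; ∈-tabulate⁻)
open import Data.List.Relation.Unary.Any using (here; there; index)
open import Data.List.Relation.Unary.Any.Properties using (lookup-index)
open import Data.List.Properties using (length-tabulate)
open import Data.Product using (Σ; ∃; _×_; _,_)
open import Data.Sum using (_⊎_; inj₁; inj₂)
open import Data.Empty using (⊥; ⊥-elim)
open import Relation.Nullary using (¬_; yes; no)
open import Relation.Binary.PropositionalEquality
open import Relation.Binary.Definitions using (tri<; tri≈; tri>)
open import Function.Definitions using (Injective)
open import Function using (_∘_)
open import Function.Bundles using (_⇔_; mk⇔; Equivalence)

open Equivalence using (to; from)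

Adj : ∀ {n} → Digraph n → Fin n → Fin n → Set
Adj D u v = D u v ⊎ D v u

TriangleFree : ∀ {n} → Digraph n → Set
TriangleFree D = ∀ {a b c} → Adj D a b → Adj D b c → Adj D a c → ⊥

record EdgeFamily (n m : ℕ) : Set where
  field
    left right      : Fin m → Fin n
    left-injective  : Injective _≡_ _≡_ left
    right-injective : Injective _≡_ _≡_ right
    no-reversal     : ∀ {e e'} → left e' ≡ right e → right e' ≡ left e → ⊥

  loopless : ∀ e → ¬ left e ≡ right e
  loopless e p = no-reversal p (sym p)

open EdgeFamily

Orients : {A : Set} → Bool → A → A → A → A → Set
Orients c a b x y = (c ≡ true × x ≡ a × y ≡ b) ⊎ (c ≡ false × x ≡ b × y ≡ a)

Orients-map : ∀ {A B : Set} {f : A → B} {c a b x y a' b'} → Injective _≡_ _≡_ f →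
  a' ≡ f a → b' ≡ f b → Orients c a b x y ⇔ Orients c a' b' (f x) (f y)
Orients-map f-inj a'≡ b'≡ = mk⇔
  (λ { (inj₁ (c , refl , refl)) → inj₁ (c , sym a'≡ , sym b'≡)
     ; (inj₂ (c , refl , refl)) → inj₂ (c , sym b'≡ , sym a'≡) })
  (λ { (inj₁ (c , p , q)) → inj₁ (c , f-inj (trans p a'≡) , f-inj (trans q b'≡))
     ; (inj₂ (c , p , q)) → inj₂ (c , f-inj (trans p b'≡) , f-inj (trans q a'≡)) })

Orients-irreflexive : ∀ {A : Set} {c} {a b x y : A} → ¬ a ≡ b → Orients c a b x y → ¬ x ≡ y
Orients-irreflexive a≢b (inj₁ (_ , refl , refl)) = a≢b
Orients-irreflexive a≢b (inj₂ (_ , refl , refl)) = λ b≡a → a≢b (sym b≡a)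

Oriented : ∀ {n m} → EdgeFamily n m → (Fin m → Bool) → Digraph n
Oriented {m = m} E o u v = Σ (Fin m) λ e → Orients (o e) (left E e) (right E e) u v

Presents : ∀ {n m} → Digraph n → EdgeFamily n m → (Fin m → Bool) → Set
Presents D E o = ∀ u v → D u v ⇔ Oriented E o u v

Covers : ∀ {n m} → EdgeFamily n m → Set
Covers {n} {m} E = ∀ (i : Fin n) → ∃ λ (e : Fin m) → i ≡ left E e ⊎ i ≡ right E e

endpointsAdjacent : ∀ {n m} {D : Digraph n} (E : EdgeFamily n m) (o : Fin m → Bool) →
  Presents D E o → ∀ e → Adj D (left E e) (right E e)
endpointsAdjacent E o present e with o e in oe
... | true  = inj₁ (from (present _ _) (e , inj₁ (oe , refl , refl)))
... | false = inj₂ (from (present _ _) (e , inj₂ (oe , refl , refl)))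

lowerBound : ∀ {n m k ℓ} {D : Digraph n} (E : EdgeFamily n m) →
  (∀ e → Adj D (left E e) (right E e)) → TriangleFree D → InS k ℓ D → m ≤ k
lowerBound {n} {m} {D = D} E adjacent triangleFree (Q , |Q|≤k , _ , f , f-inj , _ , _ , arcs) =
  ≤-trans (injective⇒≤ witnessIndex-injective) |Q|≤k
  where
  Contains : Seq → Fin n → Set
  Contains s x = Σ (Fin (length s)) λ p → lookup s p ≡ f x

  -- Distinct vertices whose types share a sequence are adjacent: the one
  -- occurring first has an arc to the other.
  cooccurring⇒adjacent : ∀ {s x y} → s ∈ Q → Contains s x → Contains s y → ¬ x ≡ y → Adj D x y
  cooccurring⇒adjacent {s} {x} {y} s∈Q (p , sp) (q , sq) x≢y with <-cmp (toℕ p) (toℕ q)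
  ... | tri< p<q _ _ = inj₁ (from (arcs x y) ((λ fx≡fy → x≢y (f-inj fx≡fy)) , s , s∈Q , p , q , p<q , sp , sq))
  ... | tri> _ _ q<p = inj₂ (from (arcs y x) ((λ fy≡fx → x≢y (sym (f-inj fy≡fx))) , s , s∈Q , q , p , q<p , sq , sp))
  ... | tri≈ _ p≡q _ = ⊥-elim (x≢y (f-inj (begin
          f x           ≡⟨ sym sp ⟩
          lookup s p    ≡⟨ cong (lookup s) (toℕ-injective p≡q) ⟩
          lookup s q    ≡⟨ sq ⟩
          f y           ∎)))
    where open ≡-Reasoning

  Witness : Fin m → Set
  Witness e = Σ Seq λ s → s ∈ Q × Contains s (left E e) × Contains s (right E e)

  witness : ∀ e → Witness e
  witness e with adjacent e
  ... | inj₁ arc with to (arcs _ _) arc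
  ...   | _ , s , s∈Q , i , j , _ , si , sj = s , s∈Q , (i , si) , (j , sj)
  witness e | inj₂ arc with to (arcs _ _) arc
  ...   | _ , s , s∈Q , i , j , _ , si , sj = s , s∈Q , (j , sj) , (i , si)

  noThirdVertex : ∀ {s e x} → s ∈ Q → Contains s (left E e) → Contains s (right E e) →
    Contains s x → ¬ x ≡ left E e → ¬ x ≡ right E e → ⊥
  noThirdVertex {e = e} s∈Q l r cx x≢l x≢r = triangleFree (adjacent e)
    (cooccurring⇒adjacent s∈Q r cx (λ eq → x≢r (sym eq)))
    (cooccurring⇒adjacent s∈Q l cx (λ eq → x≢l (sym eq)))

  onlyEdge : ∀ {s e e'} → s ∈ Q → Contains s (left E e) → Contains s (right E e) →
    Contains s (left E e') → Contains s (right E e') → e' ≡ e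
  onlyEdge {s} {e} {e'} s∈Q l r l' r'
    with left E e' Fin.≟ left E e | right E e' Fin.≟ right E e
  ... | yes p | _     = left-injective E p
  ... | no _  | yes q = right-injective E q
  ... | no ¬p | no ¬q with left E e' Fin.≟ right E e | right E e' Fin.≟ left E e
  ...   | yes p' | yes q' = ⊥-elim (no-reversal E p' q')
  ...   | no ¬p' | _      = ⊥-elim (noThirdVertex s∈Q l r l' ¬p ¬p')
  ...   | yes _  | no ¬q' = ⊥-elim (noThirdVertex s∈Q l r r' ¬q' ¬q)

  witnessIndex : Fin m → Fin (length Q)
  witnessIndex e = let (_ , s∈Q , _) = witness e in index s∈Q

  witnessIndex-injective : Injective _≡_ _≡_ witnessIndex
  witnessIndex-injective {e} {e'} same with witness e | witness e'
  ... | s , s∈Q , l , r | s' , s'∈Q , l' , r' =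
    sym (onlyEdge s∈Q l r (subst (λ t → Contains t (left E e')) s'≡s l')
                          (subst (λ t → Contains t (right E e')) s'≡s r'))
    where
    s'≡s : s' ≡ s
    s'≡s = trans (lookup-index s'∈Q) (trans (cong (lookup Q) (sym same)) (sym (lookup-index s∈Q)))

arcSeq : Bool → ℕ → ℕ → Seq
arcSeq true  x y = x ∷ y ∷ []
arcSeq false x y = y ∷ x ∷ []

Precedes : Seq → ℕ → ℕ → Set
Precedes s u v = Σ (Fin (length s)) λ i → Σ (Fin (length s)) λ j →
  toℕ i < toℕ j × lookup s i ≡ u × lookup s j ≡ v

arcSeq-precedes : ∀ c {x y u v} → Precedes (arcSeq c x y) u v ⇔ Orients c x y u v
arcSeq-precedes c = mk⇔ (forward c) backward
  where
  forward : ∀ c {x y u v} → Precedes (arcSeq c x y) u v → Orients c x y u v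
  forward true  (zero , suc zero , _ , p , q) = inj₁ (refl , sym p , sym q)
  forward false (zero , suc zero , _ , p , q) = inj₂ (refl , sym p , sym q)
  forward true  (suc zero , suc zero , s≤s () , _)
  forward false (suc zero , suc zero , s≤s () , _)
  backward : ∀ {c x y u v} → Orients c x y u v → Precedes (arcSeq c x y) u v
  backward (inj₁ (refl , refl , refl)) = zero , suc zero , s≤s z≤n , refl , refl
  backward (inj₂ (refl , refl , refl)) = zero , suc zero , s≤s z≤n , refl , refl

∈arcSeq⁺ : ∀ c {t x y} → t ≡ x ⊎ t ≡ y → t ∈ arcSeq c x y
∈arcSeq⁺ true  (inj₁ p) = here p
∈arcSeq⁺ true  (inj₂ p) = there (here p)
∈arcSeq⁺ false (inj₁ p) = there (here p)
∈arcSeq⁺ false (inj₂ p) = here p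

∈arcSeq⁻ : ∀ c {t x y} → t ∈ arcSeq c x y → t ≡ x ⊎ t ≡ y
∈arcSeq⁻ true  (here p)         = inj₁ p
∈arcSeq⁻ true  (there (here p)) = inj₂ p
∈arcSeq⁻ false (here p)         = inj₂ p
∈arcSeq⁻ false (there (here p)) = inj₁ p

occSeq-∷ : ∀ t x xs → occSeq t (x ∷ xs) ≡ occSeq t (x ∷ []) + occSeq t xs
occSeq-∷ t x xs with t ≟ x
... | yes _ = refl
... | no _  = refl

occSeq-arcSeq : ∀ t c x y → occSeq t (arcSeq c x y) ≡ occSeq t (x ∷ []) + occSeq t (y ∷ [])
occSeq-arcSeq t true  x y = occSeq-∷ t x (y ∷ [])
occSeq-arcSeq t false x y = trans (occSeq-∷ t y (x ∷ [])) (+-comm (occSeq t (y ∷ [])) _)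

occ-arcSeqs : ∀ {m} t (o : Fin m → Bool) (a b : Fin m → ℕ) →
  occ t (tabulate λ e → arcSeq (o e) (a e) (b e)) ≡ occSeq t (tabulate a) + occSeq t (tabulate b)
occ-arcSeqs {zero}  t o a b = refl
occ-arcSeqs {suc m} t o a b = begin
  occSeq t (arcSeq (o zero) (a zero) (b zero)) + occ t (tabulate λ e → arcSeq (o (suc e)) (a (suc e)) (b (suc e)))
    ≡⟨ cong₂ _+_ (occSeq-arcSeq t (o zero) (a zero) (b zero)) (occ-arcSeqs t (o ∘ suc) (a ∘ suc) (b ∘ suc)) ⟩
  (occSeq t (a zero ∷ []) + occSeq t (b zero ∷ [])) + (occSeq t (tabulate (a ∘ suc)) + occSeq t (tabulate (b ∘ suc)))
    ≡⟨ interchange (occSeq t (a zero ∷ [])) _ _ _ ⟩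
  (occSeq t (a zero ∷ []) + occSeq t (tabulate (a ∘ suc))) + (occSeq t (b zero ∷ []) + occSeq t (tabulate (b ∘ suc)))
    ≡⟨ sym (cong₂ _+_ (occSeq-∷ t (a zero) _) (occSeq-∷ t (b zero) _)) ⟩
  occSeq t (tabulate a) + occSeq t (tabulate b) ∎
  where open ≡-Reasoning

occSeq-tabulate-absent : ∀ {m} t (g : Fin m → ℕ) → (∀ i → ¬ t ≡ g i) → occSeq t (tabulate g) ≡ 0
occSeq-tabulate-absent {zero}  t g absent = refl
occSeq-tabulate-absent {suc m} t g absent with t ≟ g zero
... | yes p = ⊥-elim (absent zero p)
... | no _  = occSeq-tabulate-absent t (λ i → g (suc i)) (λ i → absent (suc i))

occSeq-tabulate-injective : ∀ {m} t (g : Fin m → ℕ) → Injective _≡_ _≡_ g → occSeq t (tabulate g) ≤ 1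
occSeq-tabulate-injective {zero}  t g g-inj = z≤n
occSeq-tabulate-injective {suc m} t g g-inj with t ≟ g zero
... | yes p = s≤s (≤-reflexive (occSeq-tabulate-absent t (λ i → g (suc i))
                (λ i q → 0≢1+n (g-inj (trans (sym p) q)))))
... | no _  = occSeq-tabulate-injective t (λ i → g (suc i)) (λ eq → suc-injective (g-inj eq))

upperBound : ∀ {n m ℓ} {D : Digraph n} (E : EdgeFamily n m) (o : Fin m → Bool) →
  Presents D E o → Covers E → 2 ≤ ℓ → InS m ℓ D
upperBound {n} {m} {ℓ} {D} E o present covers 2≤ℓ =
  Q , ≤-reflexive (length-tabulate edgeSeq) , occ≤ℓ , toℕ , toℕ-injective ,
  vertexOccurs , occurringIsVertex , arcs
  where
  a b : Fin m → ℕ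
  a e = toℕ (left E e)
  b e = toℕ (right E e)

  edgeSeq : Fin m → Seq
  edgeSeq e = arcSeq (o e) (a e) (b e)

  Q : List Seq
  Q = tabulate edgeSeq

  occ≤ℓ : ∀ t → occ t Q ≤ ℓ
  occ≤ℓ t = ≤-trans (≤-reflexive (occ-arcSeqs t o a b)) (≤-trans
    (+-mono-≤ (occSeq-tabulate-injective t a (λ eq → left-injective E (toℕ-injective eq)))
                (occSeq-tabulate-injective t b (λ eq → right-injective E (toℕ-injective eq))))
    2≤ℓ)

  vertexOccurs : ∀ i → Occurs (toℕ i) Q
  vertexOccurs i with covers i
  ... | e , inj₁ refl = edgeSeq e , ∈-tabulate⁺ e , ∈arcSeq⁺ (o e) (inj₁ refl)
  ... | e , inj₂ refl = edgeSeq e , ∈-tabulate⁺ e , ∈arcSeq⁺ (o e) (inj₂ refl)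

  occurringIsVertex : ∀ t → Occurs t Q → ∃ λ i → toℕ i ≡ t
  occurringIsVertex t (s , s∈Q , t∈s) with ∈-tabulate⁻ s∈Q
  ... | e , refl with ∈arcSeq⁻ (o e) t∈s
  ...   | inj₁ p = left E e , sym p
  ...   | inj₂ p = right E e , sym p

  onTypes : ∀ e {u v} → Orients (o e) (left E e) (right E e) u v ⇔ Orients (o e) (a e) (b e) (toℕ u) (toℕ v)
  onTypes e = Orients-map toℕ-injective refl refl

  arcs : ∀ u v → D u v ⇔ GArc Q (toℕ u) (toℕ v)
  arcs u v = mk⇔
    (λ arc → let (e , r) = to (present u v) arc in
      (λ eq → Orients-irreflexive (loopless E e) r (toℕ-injective eq)) ,
      edgeSeq e , ∈-tabulate⁺ e , from (arcSeq-precedes (o e)) (to (onTypes e) r))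
    (λ { (_ , s , s∈Q , precedes) → fromEdgeSeq (∈-tabulate⁻ s∈Q) precedes })
    where
    fromEdgeSeq : ∀ {s} → (∃ λ e → s ≡ edgeSeq e) → Precedes s (toℕ u) (toℕ v) → D u v
    fromEdgeSeq (e , refl) precedes = from (present u v) (e , from (onTypes e) (to (arcSeq-precedes (o e)) precedes))

sequenceNumber : ∀ {n m} {D : Digraph n} (E : EdgeFamily n m) (o : Fin m → Bool) →
  Presents D E o → Covers E → TriangleFree D →
  (∀ ℓ → 2 ≤ ℓ → InS m ℓ D) × (∀ {k ℓ} → InS k ℓ D → m ≤ k)
sequenceNumber E o present covers triangleFree =
  (λ ℓ 2≤ℓ → upperBound E o present covers 2≤ℓ) ,
  lowerBound E (endpointsAdjacent E o present) triangleFree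

pathEdges : ∀ k → EdgeFamily (suc (suc k)) (suc k)
pathEdges k = record
  { left = inject₁ ; right = suc
  ; left-injective = inject₁-injective ; right-injective = suc-injective
  ; no-reversal = λ {e} {e'} p q → 2+n≢n (begin
      suc (suc (toℕ e))     ≡⟨ cong suc (sym (trans (sym (toℕ-inject₁ e')) (cong toℕ p))) ⟩
      suc (toℕ e')          ≡⟨ trans (cong toℕ q) (toℕ-inject₁ e) ⟩
      toℕ e                 ∎) }
  where
  open ≡-Reasoning
  2+n≢n : ∀ {x} → ¬ suc (suc x) ≡ x
  2+n≢n ()

pathPresented : ∀ {k} (o : Fin (suc k) → Bool) → Presents (PathOr (suc (suc k)) o) (pathEdges k) o
pathPresented o u v = mk⇔
  (λ { (e , r) → e , from (onTypes e) r })
  (λ { (e , r) → e , to (onTypes e) r })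
  where
  onTypes : ∀ e → Orients (o e) (inject₁ e) (suc e) u v ⇔ Orients (o e) (toℕ e) (suc (toℕ e)) (toℕ u) (toℕ v)
  onTypes e = Orients-map toℕ-injective (sym (toℕ-inject₁ e)) refl

pathCovered : ∀ k → Covers (pathEdges k)
pathCovered k zero    = zero , inj₁ refl
pathCovered k (suc i) = i , inj₂ refl

data PathAdj : ℕ → ℕ → Set where
  forward  : ∀ x → PathAdj x (suc x)
  backward : ∀ x → PathAdj (suc x) x

PathAdj-sym : ∀ {x y} → PathAdj x y → PathAdj y x
PathAdj-sym (forward x)  = backward x
PathAdj-sym (backward x) = forward x

PathAdj-triangle : ∀ {x y z} → PathAdj x y → PathAdj y z → PathAdj x z → ⊥
PathAdj-triangle (forward _)  (forward _)  ()
PathAdj-triangle (forward _)  (backward _) ()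
PathAdj-triangle (backward _) (forward _)  ()
PathAdj-triangle (backward _) (backward _) ()

pathTriangleFree : ∀ {n} (o : Fin (pred n) → Bool) → TriangleFree (PathOr n o)
pathTriangleFree o ab bc ac = PathAdj-triangle (onℕ ab) (onℕ bc) (onℕ ac)
  where
  arcOnℕ : ∀ {u v} → PathOr _ o u v → PathAdj (toℕ u) (toℕ v)
  arcOnℕ (e , inj₁ (_ , p , q)) rewrite p | q = forward _
  arcOnℕ (e , inj₂ (_ , p , q)) rewrite p | q = backward _
  onℕ : ∀ {u v} → Adj (PathOr _ o) u v → PathAdj (toℕ u) (toℕ v)
  onℕ (inj₁ arc) = arcOnℕ arc
  onℕ (inj₂ arc) = PathAdj-sym (arcOnℕ arc)

data CycleSucc : ℕ → ℕ → ℕ → Set where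
  step : ∀ {n} x → CycleSucc n x (suc x)
  wrap : ∀ x → CycleSucc (suc x) x 0

CycleSucc-injective : ∀ {n x y z} → CycleSucc n x z → CycleSucc n y z → x ≡ y
CycleSucc-injective (step _) (step _) = refl
CycleSucc-injective (wrap _) (wrap _) = refl

CycleSucc-no-2-cycle : ∀ {k x y} → CycleSucc (3 + k) x y → CycleSucc (3 + k) y x → ⊥
CycleSucc-no-2-cycle (step _) ()
CycleSucc-no-2-cycle (wrap _) ()

Next⇒CycleSucc : ∀ {n} {e w : Fin n} → Next e w → CycleSucc n (toℕ e) (toℕ w)
Next⇒CycleSucc {n} {e} (inj₁ r) = subst (CycleSucc n (toℕ e)) r (step (toℕ e))
Next⇒CycleSucc {n} {e} (inj₂ (r , s)) =
  subst₂ (λ n' w → CycleSucc n' (toℕ e) w) r (sym s) (wrap (toℕ e))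

next : ∀ {n} → Fin (suc n) → Fin (suc n)
next {n} e = suc (toℕ e) mod suc n

next-spec : ∀ {n} (e : Fin (suc n)) → Next e (next e)
next-spec {n} e with m≤n⇒m<n∨m≡n (toℕ<n e)
... | inj₁ e+1<n = inj₁ (sym (trans (toℕ-fromℕ< _) (m<n⇒m%n≡m e+1<n)))
... | inj₂ e+1≡n = inj₂ (e+1≡n , trans (toℕ-fromℕ< _) (trans (cong (_% suc n) e+1≡n) (n%n≡0 (suc n))))

-- A vertex has only one cyclic successor: the step e+1 and the wrap-around
-- to 0 exclude each other, since e+1 = n is not a vertex.
Next-functional : ∀ {n} {e w w' : Fin n} → Next e w → Next e w' → w ≡ w'
Next-functional (inj₁ r)       (inj₁ r')        = toℕ-injective (trans (sym r) r')
Next-functional (inj₂ (_ , s)) (inj₂ (_ , s'))  = toℕ-injective (trans s (sym s'))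
Next-functional {w = w}   (inj₁ r) (inj₂ (p , _)) = ⊥-elim (<⇒≢ (toℕ<n w) (trans (sym r) p))
Next-functional {w' = w'} (inj₂ (p , _)) (inj₁ r') = ⊥-elim (<⇒≢ (toℕ<n w') (trans (sym r') p))

Next⇔next : ∀ {n} {e w : Fin (suc n)} → Next e w ⇔ w ≡ next e
Next⇔next {e = e} = mk⇔ (λ nx → Next-functional nx (next-spec e)) (λ { refl → next-spec e })

cycleEdges : ∀ k → EdgeFamily (3 + k) (3 + k)
cycleEdges k = record
  { left = λ e → e ; right = next
  ; left-injective = λ eq → eq
  ; right-injective = λ {e} {e'} eq → toℕ-injective (CycleSucc-injective
      (Next⇒CycleSucc (next-spec e)) (Next⇒CycleSucc (subst (Next e') (sym eq) (next-spec e'))))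
  ; no-reversal = λ {e} {e'} p q → CycleSucc-no-2-cycle
      (Next⇒CycleSucc (from Next⇔next p)) (Next⇒CycleSucc (from Next⇔next (sym q))) }

cyclePresented : ∀ {k} (o : Fin (3 + k) → Bool) → Presents (CycleOr (3 + k) o) (cycleEdges k) o
cyclePresented o u v = mk⇔
  (λ { (e , inj₁ (c , p , nx)) → e , inj₁ (c , p , to Next⇔next nx)
     ; (e , inj₂ (c , nx , q)) → e , inj₂ (c , to Next⇔next nx , q) })
  (λ { (e , inj₁ (c , p , q)) → e , inj₁ (c , p , from Next⇔next q)
     ; (e , inj₂ (c , p , q)) → e , inj₂ (c , from Next⇔next p , q) })

cycleCovered : ∀ k → Covers (cycleEdges k)
cycleCovered k i = i , inj₁ refl

data CycleAdj : ℕ → ℕ → ℕ → Set where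
  forward      : ∀ {n} x → CycleAdj n x (suc x)
  backward     : ∀ {n} x → CycleAdj n (suc x) x
  wrapForward  : ∀ x → CycleAdj (suc x) x 0
  wrapBackward : ∀ x → CycleAdj (suc x) 0 x

CycleSucc⇒CycleAdj : ∀ {n x y} → CycleSucc n x y → CycleAdj n x y
CycleSucc⇒CycleAdj (step x) = forward x
CycleSucc⇒CycleAdj (wrap x) = wrapForward x

CycleAdj-sym : ∀ {n x y} → CycleAdj n x y → CycleAdj n y x
CycleAdj-sym (forward x)      = backward x
CycleAdj-sym (backward x)     = forward x
CycleAdj-sym (wrapForward x)  = wrapBackward x
CycleAdj-sym (wrapBackward x) = wrapForward x

CycleAdj-triangle : ∀ {k x y z} → CycleAdj (4 + k) x y → CycleAdj (4 + k) y z → CycleAdj (4 + k) x z → ⊥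
CycleAdj-triangle (forward _)      (forward _)      ()
CycleAdj-triangle (forward _)      (backward _)     ()
CycleAdj-triangle (forward _)      (wrapForward _)  ()
CycleAdj-triangle (backward _)     (forward _)      ()
CycleAdj-triangle (backward _)     (backward _)     ()
CycleAdj-triangle (backward _)     (wrapForward _)  ()
CycleAdj-triangle (backward _)     (wrapBackward _) ()
CycleAdj-triangle (wrapForward _)  (forward _)      ()
CycleAdj-triangle (wrapForward _)  (wrapBackward _) ()
CycleAdj-triangle (wrapBackward _) (forward _)      ()
CycleAdj-triangle (wrapBackward _) (backward _)     ()
CycleAdj-triangle (wrapBackward _) (wrapForward _)  ()

cycleTriangleFree : ∀ {k} (o : Fin (4 + k) → Bool) → TriangleFree (CycleOr (4 + k) o)
cycleTriangleFree o ab bc ac = CycleAdj-triangle (onℕ ab) (onℕ bc) (onℕ ac)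
  where
  arcOnℕ : ∀ {u v} → CycleOr _ o u v → CycleAdj _ (toℕ u) (toℕ v)
  arcOnℕ (e , inj₁ (_ , refl , nx)) = CycleSucc⇒CycleAdj (Next⇒CycleSucc nx)
  arcOnℕ (e , inj₂ (_ , nx , refl)) = CycleAdj-sym (CycleSucc⇒CycleAdj (Next⇒CycleSucc nx))
  onℕ : ∀ {u v} → Adj (CycleOr _ o) u v → CycleAdj _ (toℕ u) (toℕ v)
  onℕ (inj₁ arc) = arcOnℕ arc
  onℕ (inj₂ arc) = CycleAdj-sym (arcOnℕ arc)

lemma4p12 : ((n : ℕ) → 2 ≤ n → (o : Fin (pred n) → Bool) →
    ((ℓ : ℕ) → 2 ≤ ℓ → InS (n ∸ 1) ℓ (PathOr n o)) ×
    ((ℓ : ℕ) → 1 ≤ ℓ → ¬ InS (n ∸ 2) ℓ (PathOr n o)))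
    ×
    ((n : ℕ) → 4 ≤ n → (o : Fin n → Bool) →
    ((ℓ : ℕ) → 2 ≤ ℓ → InS n ℓ (CycleOr n o)) ×
    ((ℓ : ℕ) → 1 ≤ ℓ → ¬ InS (n ∸ 1) ℓ (CycleOr n o)))
lemma4p12 = path , cycle
  where
  path : (n : ℕ) → 2 ≤ n → (o : Fin (pred n) → Bool) →
    ((ℓ : ℕ) → 2 ≤ ℓ → InS (n ∸ 1) ℓ (PathOr n o)) ×
    ((ℓ : ℕ) → 1 ≤ ℓ → ¬ InS (n ∸ 2) ℓ (PathOr n o))
  path (suc zero) (s≤s ()) _
  path (suc (suc k)) _ o with sequenceNumber (pathEdges k) o (pathPresented o) (pathCovered k) (pathTriangleFree o)
  ... | realisable , needed = realisable , λ ℓ _ realisation → 1+n≰n (needed realisation)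

  cycle : (n : ℕ) → 4 ≤ n → (o : Fin n → Bool) →
    ((ℓ : ℕ) → 2 ≤ ℓ → InS n ℓ (CycleOr n o)) ×
    ((ℓ : ℕ) → 1 ≤ ℓ → ¬ InS (n ∸ 1) ℓ (CycleOr n o))
  cycle (suc (suc (suc zero))) (s≤s (s≤s (s≤s ()))) _
  cycle (suc (suc (suc (suc k)))) _ o
    with sequenceNumber (cycleEdges (suc k)) o (cyclePresented o) (cycleCovered (suc k)) (cycleTriangleFree o)
  ... | realisable , needed = realisable , λ ℓ _ realisation → 1+n≰n (needed realisation)
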